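{- Let $A$ be a $\forall^+$ type of system $\mathcal F$ and $t$ a $\lambda$-term. (i) If $t\in|A|$, then $t$ is normalizable and $\beta$-equivalent to a closed term. (ii) $|A|$ is stable under $\beta$-equivalence: if $t\in|A|$ and $t\simeq_\beta t'$, then $t'\in|A|$.
   Context: $\Lambda$ denotes the set of pure $\lambda$-terms; application is written $(t)u$; $\simeq_\beta$ is $\beta$-equivalence. $u\succ_f v$ means $v$ is obtained from $u$ by zero or more weak head reduction steps (contracting $(\lambda x u)v$ in a term $(\lambda x u)v v_1\dots v_m$). System $\mathcal F$ types are built from type variables with $\rightarrow$ and $\forall$ (typing rules: variable axiom; $\rightarrow$-introduction; $\rightarrow$-elimination; $\forall$-introduction on a variable not occurring in the context; $\forall$-elimination $\forall XA\Rightarrow A[C/X]$ for any type $C$). A set $G\subseteq\Lambda$ is saturated if $u\in G$ and $t\succ_f u$ imply $t\in G$. $G\rightarrow G'=\{u:(u)t\in G'\ \forall t\in G\}$. An interpretation $I$ assigns to each type variable a saturated set $|X|_I$; $|A\rightarrow B|_I=|A|_I\rightarrow|B|_I$, $|\forall XA|_I=\bigcap\{|A|_{I[X\leftarrow G]}:G\text{ saturated}\}$, where $I[X\leftarrow G]$ sends $X$ to $G$ and agrees with $I$ elsewhere. $|A|=\bigcap\{|A|_I: I\text{ interpretation}\}$. $\forall^+$/$\forall^-$ types: a type variable is both; if $A$ is $\forall^+$ (resp. $\forall^-$) and $B$ is $\forall^-$ (resp. $\forall^+$) then $B\rightarrow A$ is $\forall^+$ (resp. $\forall^-$); if $A$ is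 $\forall^+$ and $X$ is free in $A$ then $\forall XA$ is $\forall^+$. -}

module Defs where

open import Level using (Level; Lift; lift; 0ℓ) renaming (suc to lsuc)
open import Data.Nat using (ℕ; zero; suc; _<_; _≟_)
open import Data.Product using (Σ; ∃; _×_; _,_; proj₁)
open import Relation.Nullary using (¬_; yes; no)
open import Relation.Binary.PropositionalEquality using (_≡_)
open import Relation.Binary.Construct.Closure.ReflexiveTransitive using (Star)
open import Relation.Binary.Construct.Closure.Equivalence using (EqClosure)

-- Pure λ-terms (de Bruijn indices); app t u is the paper's (t)u.

data Λ : Set where
  var : ℕ → Λ
  lam : Λ → Λ
  app : Λ → Λ → Λ

ext : (ℕ → ℕ) → ℕ → ℕ
ext r zero    = zero
ext r (suc n) = suc (r n)

rename : (ℕ → ℕ) → Λ → Λ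
rename r (var n)   = var (r n)
rename r (lam t)   = lam (rename (ext r) t)
rename r (app t u) = app (rename r t) (rename r u)

exts : (ℕ → Λ) → ℕ → Λ
exts σ zero    = var zero
exts σ (suc n) = rename suc (σ n)

subst : (ℕ → Λ) → Λ → Λ
subst σ (var n)   = σ n
subst σ (lam t)   = lam (subst (exts σ) t)
subst σ (app t u) = app (subst σ t) (subst σ u)

_[_] : Λ → Λ → Λ
t [ v ] = subst σ t
  where
  σ : ℕ → Λ
  σ zero    = v
  σ (suc n) = var n

data _→β_ : Λ → Λ → Set where
  β    : ∀ {t v} → app (lam t) v →β (t [ v ])
  ξlam : ∀ {t t'} → t →β t' → lam t →β lam t'
  ξl   : ∀ {t t' u} → t →β t' → app t u →β app t' u
  ξr   : ∀ {t u u'} → u →β u' → app t u →β app t u'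

_→β*_ : Λ → Λ → Set
_→β*_ = Star _→β_

_≃β_ : Λ → Λ → Set
_≃β_ = EqClosure _→β_

Normal : Λ → Set
Normal t = ∀ {t'} → ¬ (t →β t')

Normalizable : Λ → Set
Normalizable t = ∃ λ n → (t →β* n) × Normal n

ClosedUnder : ℕ → Λ → Set
ClosedUnder k (var n)   = n < k
ClosedUnder k (lam t)   = ClosedUnder (suc k) t
ClosedUnder k (app t u) = ClosedUnder k t × ClosedUnder k u

Closed : Λ → Set
Closed = ClosedUnder 0

data _→wh_ : Λ → Λ → Set where
  whβ  : ∀ {t v} → app (lam t) v →wh (t [ v ])
  whap : ∀ {t t' w} → t →wh t' → app t w →wh app t' w

_≻f_ : Λ → Λ → Set
_≻f_ = Star _→wh_

Saturated : (Λ → Set) → Set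
Saturated G = ∀ {t u} → G u → t ≻f u → G t

SatSet : Set₁
SatSet = Σ (Λ → Set) Saturated

data Ty : Set where
  tvar : ℕ → Ty
  _⇒_  : Ty → Ty → Ty
  all  : ℕ → Ty → Ty

infixr 5 _⇒_

data FreeIn (X : ℕ) : Ty → Set where
  fvar : FreeIn X (tvar X)
  fl   : ∀ {A B} → FreeIn X A → FreeIn X (A ⇒ B)
  fr   : ∀ {A B} → FreeIn X B → FreeIn X (A ⇒ B)
  fall : ∀ {Y A} → ¬ (Y ≡ X) → FreeIn X A → FreeIn X (all Y A)

data ForallPos : Ty → Set
data ForallNeg : Ty → Set

data ForallPos where
  pvar : ∀ {X} → ForallPos (tvar X)
  parr : ∀ {A B} → ForallNeg B → ForallPos A → ForallPos (B ⇒ A)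
  pall : ∀ {X A} → ForallPos A → FreeIn X A → ForallPos (all X A)

data ForallNeg where
  nvar : ∀ {X} → ForallNeg (tvar X)
  narr : ∀ {A B} → ForallPos B → ForallNeg A → ForallNeg (B ⇒ A)

Interp : Set₁
Interp = ℕ → SatSet

_[_←_] : Interp → ℕ → SatSet → Interp
(I [ X ← G ]) Y with Y ≟ X
... | yes _ = G
... | no  _ = I Y

⟦_⟧_ : Ty → Interp → Λ → Set₁
(⟦ tvar X ⟧ I) t = Lift (lsuc 0ℓ) (proj₁ (I X) t)
(⟦ A ⇒ B ⟧ I) t = ∀ u → (⟦ A ⟧ I) u → (⟦ B ⟧ I) (app t u)
(⟦ all X A ⟧ I) t = (G : SatSet) → (⟦ A ⟧ (I [ X ← G ])) t

∣_∣ : Ty → Λ → Set₁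
∣ A ∣ t = (I : Interp) → (⟦ A ⟧ I) t

module Submission where

-- Fix a bound b.  Variables x ≥ b are "generic": each carries an entry
-- (N , ρ), a type N read through a renaming ρ of its type variables, and
-- every entry is carried by arbitrarily large generic variables (this uses
-- a coding of entries by natural numbers).  The inductive predicate
-- Real ρ P t says that t behaves like a term of type P built from generic
-- variables: at an arrow it realizes the result when applied to a fresh
-- generic variable of the argument type, at ∀ for every instance, and at
-- a type variable it weak-head reduces to a spine (x) w₁ … wₖ of generic
-- variables ending in that type variable.  Four facts about Real:
--   reify      : an element of |P| for P ∀⁺ satisfies Real (take the
--                interpretation sending each type variable to the set of
--                terms weak-head reducing to a spine of that type);
--   normalize  : a realizer has a normal form whose free variables are generic;
--   stability  : Real is closed under ≃β; the key point is that weak head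
--                spines are stable under ≃β, proved from Church–Rosser and
--                the standardization theorem;
--   soundness  : substituting, for every generic variable, an element of
--                the interpretation of its entry turns a realizer of P into
--                an element of |P|_I.
-- Part (i) takes b above the free variables of t: the normal form then has
-- only generic free variables, none of which is free in t, so it is closed.
-- Part (ii) applies stability and then soundness with the identity
-- substitution.

open import Defs
open import Level using (lift)
open import Function using (_∘_)
open import Data.Nat using (ℕ; zero; suc; _<_; _≤_; _⊔_; _∸_; _+_; z≤n; s≤s; _≟_)
open import Data.Nat.Properties
  using (≤-refl; ≤-trans; <-≤-trans; <⇒≤; <⇒≢; <⇒≱; n≤1+n; m≤m⊔n; m≤n⊔m; ⊔-lub; m≤m+n; m≤n+m; +-suc; +-identityʳ; m+n∸m≡n; n∸n≡0)
open import Data.Product using (∃; _×_; _,_; proj₁; proj₂)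
open import Data.Sum using (_⊎_; inj₁; inj₂)
open import Data.List using (List; []; _∷_)
open import Data.Empty using (⊥-elim)
open import Relation.Nullary using (¬_; yes; no)
open import Relation.Binary.PropositionalEquality
  using (_≡_; refl; sym; trans; cong; cong₂; subst₂; module ≡-Reasoning) renaming (subst to ≡subst)
open import Relation.Binary.Construct.Closure.ReflexiveTransitive using (Star; ε; _◅_; _◅◅_; gmap)
open import Relation.Binary.Construct.Closure.Symmetric using (fwd; bwd)
import Relation.Binary.Construct.Closure.Equivalence as EqClosure

infix 4 _≗_
_≗_ : {A : Set} → (ℕ → A) → (ℕ → A) → Set
f ≗ g = ∀ n → f n ≡ g n

ext-cong : ∀ {r r'} → r ≗ r' → ext r ≗ ext r'
ext-cong e zero    = refl
ext-cong e (suc n) = cong suc (e n)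

rename-cong : ∀ {r r'} → r ≗ r' → ∀ t → rename r t ≡ rename r' t
rename-cong e (var n)   = cong var (e n)
rename-cong e (lam t)   = cong lam (rename-cong (ext-cong e) t)
rename-cong e (app t u) = cong₂ app (rename-cong e t) (rename-cong e u)

exts-cong : ∀ {σ τ} → σ ≗ τ → exts σ ≗ exts τ
exts-cong e zero    = refl
exts-cong e (suc n) = cong (rename suc) (e n)

subst-cong : ∀ {σ τ} → σ ≗ τ → ∀ t → subst σ t ≡ subst τ t
subst-cong e (var n)   = e n
subst-cong e (lam t)   = cong lam (subst-cong (exts-cong e) t)
subst-cong e (app t u) = cong₂ app (subst-cong e t) (subst-cong e u)

rename-rename : ∀ r r' t → rename r (rename r' t) ≡ rename (r ∘ r') t
rename-rename r r' (var n)   = refl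
rename-rename r r' (lam t)   =
  cong lam (trans (rename-rename (ext r) (ext r') t) (rename-cong ext-∘ t))
  where
  ext-∘ : ext r ∘ ext r' ≗ ext (r ∘ r')
  ext-∘ zero    = refl
  ext-∘ (suc n) = refl
rename-rename r r' (app t u) = cong₂ app (rename-rename r r' t) (rename-rename r r' u)

rename-subst : ∀ r σ t → rename r (subst σ t) ≡ subst (rename r ∘ σ) t
rename-subst r σ (var n)   = refl
rename-subst r σ (lam t)   =
  cong lam (trans (rename-subst (ext r) (exts σ) t) (subst-cong ext-exts t))
  where
  ext-exts : rename (ext r) ∘ exts σ ≗ exts (rename r ∘ σ)
  ext-exts zero    = refl
  ext-exts (suc n) = trans (rename-rename (ext r) suc (σ n)) (sym (rename-rename suc r (σ n)))
rename-subst r σ (app t u) = cong₂ app (rename-subst r σ t) (rename-subst r σ u)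

subst-rename : ∀ σ r t → subst σ (rename r t) ≡ subst (σ ∘ r) t
subst-rename σ r (var n)   = refl
subst-rename σ r (lam t)   =
  cong lam (trans (subst-rename (exts σ) (ext r) t) (subst-cong exts-ext t))
  where
  exts-ext : exts σ ∘ ext r ≗ exts (σ ∘ r)
  exts-ext zero    = refl
  exts-ext (suc n) = refl
subst-rename σ r (app t u) = cong₂ app (subst-rename σ r t) (subst-rename σ r u)

subst-subst : ∀ σ τ t → subst σ (subst τ t) ≡ subst (subst σ ∘ τ) t
subst-subst σ τ (var n)   = refl
subst-subst σ τ (lam t)   =
  cong lam (trans (subst-subst (exts σ) (exts τ) t) (subst-cong exts-exts t))
  where
  exts-exts : subst (exts σ) ∘ exts τ ≗ exts (subst σ ∘ τ)
  exts-exts zero    = refl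
  exts-exts (suc n) = trans (subst-rename (exts σ) suc (τ n)) (sym (rename-subst suc σ (τ n)))
subst-subst σ τ (app t u) = cong₂ app (subst-subst σ τ t) (subst-subst σ τ u)

subst-id : ∀ t → subst var t ≡ t
subst-id (var n)   = refl
subst-id (lam t)   = cong lam (trans (subst-cong exts-var t) (subst-id t))
  where
  exts-var : exts var ≗ var
  exts-var zero    = refl
  exts-var (suc n) = refl
subst-id (app t u) = cong₂ app (subst-id t) (subst-id u)

rename-as-subst : ∀ r t → rename r t ≡ subst (var ∘ r) t
rename-as-subst r t = trans (sym (subst-id (rename r t))) (subst-rename var r t)

single : Λ → ℕ → Λ
single v zero    = v
single v (suc n) = var n

[]-as-subst : ∀ t v → t [ v ] ≡ subst (single v) t
[]-as-subst t v = subst-cong same t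
  where
  same : _ ≗ single v
  same zero    = refl
  same (suc n) = refl

subst-[] : ∀ σ t v → subst σ (t [ v ]) ≡ (subst (exts σ) t) [ subst σ v ]
subst-[] σ t v = begin
  subst σ (t [ v ])                              ≡⟨ cong (subst σ) ([]-as-subst t v) ⟩
  subst σ (subst (single v) t)                   ≡⟨ subst-subst σ (single v) t ⟩
  subst (subst σ ∘ single v) t                   ≡⟨ subst-cong commute t ⟩
  subst (subst (single (subst σ v)) ∘ exts σ) t  ≡⟨ sym (subst-subst (single (subst σ v)) (exts σ) t) ⟩
  subst (single (subst σ v)) (subst (exts σ) t)  ≡⟨ sym ([]-as-subst (subst (exts σ) t) (subst σ v)) ⟩
  (subst (exts σ) t) [ subst σ v ]               ∎
  where
  open ≡-Reasoning
  commute : subst σ ∘ single v ≗ subst (single (subst σ v)) ∘ exts σ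
  commute zero    = refl
  commute (suc n) = sym (trans (subst-rename (single (subst σ v)) suc (σ n)) (subst-id (σ n)))

rename-[] : ∀ r t v → rename r (t [ v ]) ≡ (rename (ext r) t) [ rename r v ]
rename-[] r t v = begin
  rename r (t [ v ])                                  ≡⟨ rename-as-subst r _ ⟩
  subst (var ∘ r) (t [ v ])                           ≡⟨ subst-[] _ t v ⟩
  (subst (exts (var ∘ r)) t) [ subst (var ∘ r) v ]    ≡⟨ cong₂ _[_] ext-as-subst (sym (rename-as-subst r v)) ⟩
  (rename (ext r) t) [ rename r v ]                   ∎
  where
  open ≡-Reasoning
  ext-exts : var ∘ ext r ≗ exts (var ∘ r)
  ext-exts zero    = refl
  ext-exts (suc n) = refl
  ext-as-subst : subst (exts (var ∘ r)) t ≡ rename (ext r) t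
  ext-as-subst = trans (sym (subst-cong ext-exts t)) (sym (rename-as-subst (ext r) t))

instantiate : ℕ → ℕ → ℕ
instantiate x zero    = x
instantiate x (suc n) = n

[var]-as-rename : ∀ c x → c [ var x ] ≡ rename (instantiate x) c
[var]-as-rename c x =
  trans ([]-as-subst c (var x)) (trans (subst-cong same c) (sym (rename-as-subst (instantiate x) c)))
  where
  same : single (var x) ≗ var ∘ instantiate x
  same zero    = refl
  same (suc n) = refl

data Free : ℕ → Λ → Set where
  fv   : ∀ {n} → Free n (var n)
  flam : ∀ {n t} → Free (suc n) t → Free n (lam t)
  fapl : ∀ {n t u} → Free n t → Free n (app t u)
  fapr : ∀ {n t u} → Free n u → Free n (app t u)

bound : Λ → ℕ
bound (var n)   = suc n
bound (lam t)   = bound t ∸ 1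
bound (app t u) = bound t ⊔ bound u

free-bound : ∀ {n t} → Free n t → n < bound t
free-bound fv = s≤s ≤-refl
free-bound {n} {lam t} (flam f) with bound t | free-bound f
... | suc k | s≤s p = p
free-bound {t = app t u} (fapl f) = <-≤-trans (free-bound f) (m≤m⊔n (bound t) (bound u))
free-bound {t = app t u} (fapr f) = <-≤-trans (free-bound f) (m≤n⊔m (bound t) (bound u))

closedUnder : ∀ k t → (∀ n → Free n t → n < k) → ClosedUnder k t
closedUnder k (var n)   h = h n fv
closedUnder k (lam t)   h = closedUnder (suc k) t under-suc
  where
  under-suc : ∀ n → Free n t → n < suc k
  under-suc zero    f = s≤s z≤n
  under-suc (suc n) f = s≤s (h n (flam f))
closedUnder k (app t u) h = closedUnder k t (λ n f → h n (fapl f)) , closedUnder k u (λ n f → h n (fapr f))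

free-rename : ∀ {r n t} → Free n t → Free (r n) (rename r t)
free-rename fv       = fv
free-rename (flam f) = flam (free-rename f)
free-rename (fapl f) = fapl (free-rename f)
free-rename (fapr f) = fapr (free-rename f)

free-rename⁻ : ∀ {r m} t → Free m (rename r t) → ∃ λ k → Free k t × r k ≡ m
free-rename⁻ (var n) fv = n , fv , refl
free-rename⁻ {r} (lam t) (flam f) with free-rename⁻ {ext r} t f
... | suc k , f' , refl = k , flam f' , refl
free-rename⁻ (app t u) (fapl f) with free-rename⁻ t f
... | k , f' , e = k , fapl f' , e
free-rename⁻ (app t u) (fapr f) with free-rename⁻ u f
... | k , f' , e = k , fapr f' , e

free-subst⁻ : ∀ {σ m} t → Free m (subst σ t) → ∃ λ k → Free k t × Free m (σ k)
free-subst⁻ (var n) f = n , fv , f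
free-subst⁻ {σ} (lam t) (flam f) with free-subst⁻ {exts σ} t f
... | zero  , f1 , ()
... | suc k , f1 , f2 with free-rename⁻ (σ k) f2
...   | j , f3 , refl = k , flam f1 , f3
free-subst⁻ (app t u) (fapl f) with free-subst⁻ t f
... | k , f1 , f2 = k , fapl f1 , f2
free-subst⁻ (app t u) (fapr f) with free-subst⁻ u f
... | k , f1 , f2 = k , fapr f1 , f2

subst-agree : ∀ {σ τ} t → (∀ n → Free n t → σ n ≡ τ n) → subst σ t ≡ subst τ t
subst-agree (var n) h = h n fv
subst-agree {σ} {τ} (lam t) h = cong lam (subst-agree t agree-exts)
  where
  agree-exts : ∀ n → Free n t → exts σ n ≡ exts τ n
  agree-exts zero    f = refl
  agree-exts (suc n) f = cong (rename suc) (h n (flam f))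
subst-agree (app t u) h =
  cong₂ app (subst-agree t (λ n f → h n (fapl f))) (subst-agree u (λ n f → h n (fapr f)))

β-free : ∀ {t t' y} → t →β t' → Free y t' → Free y t
β-free {app (lam c) v} {y = y} β f with free-subst⁻ {single v} c (≡subst (Free y) ([]-as-subst c v) f)
... | zero  , f1 , f2 = fapr f2
... | suc k , f1 , fv = fapl (flam f1)
β-free (ξlam s) (flam f) = flam (β-free s f)
β-free (ξl s)   (fapl f) = fapl (β-free s f)
β-free (ξl s)   (fapr f) = fapr f
β-free (ξr s)   (fapl f) = fapl f
β-free (ξr s)   (fapr f) = fapr (β-free s f)

β*-free : ∀ {t t' y} → t →β* t' → Free y t' → Free y t
β*-free ε        f = f
β*-free (s ◅ ss) f = β-free s (β*-free ss f)

wh⊆β : ∀ {t t'} → t →wh t' → t →β t'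
wh⊆β whβ      = β
wh⊆β (whap s) = ξl (wh⊆β s)

≻f⊆β* : ∀ {t t'} → t ≻f t' → t →β* t'
≻f⊆β* = gmap (λ x → x) wh⊆β

wh-subst : ∀ σ {t t'} → t →wh t' → subst σ t →wh subst σ t'
wh-subst σ (whβ {t} {v}) =
  ≡subst (app (lam (subst (exts σ) t)) (subst σ v) →wh_) (sym (subst-[] σ t v)) whβ
wh-subst σ (whap s) = whap (wh-subst σ s)

≻f-subst : ∀ σ {t t'} → t ≻f t' → subst σ t ≻f subst σ t'
≻f-subst σ = gmap (subst σ) (wh-subst σ)

≻f-rename : ∀ r {t t'} → t ≻f t' → rename r t ≻f rename r t'
≻f-rename r {t} {t'} s =
  subst₂ _≻f_ (sym (rename-as-subst r t)) (sym (rename-as-subst r t')) (≻f-subst (var ∘ r) s)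

β-rename : ∀ r {t t'} → t →β t' → rename r t →β rename r t'
β-rename r (β {t} {v}) =
  ≡subst (app (lam (rename (ext r) t)) (rename r v) →β_) (sym (rename-[] r t v)) β
β-rename r (ξlam s) = ξlam (β-rename (ext r) s)
β-rename r (ξl s)   = ξl (β-rename r s)
β-rename r (ξr s)   = ξr (β-rename r s)

β-rename⁻ : ∀ r t {s} → rename r t →β s → ∃ λ t' → t →β t' × s ≡ rename r t'
β-rename⁻ r (var n) ()
β-rename⁻ r (lam t) (ξlam st) with β-rename⁻ (ext r) t st
... | t' , a , refl = lam t' , ξlam a , refl
β-rename⁻ r (app (lam c) v) β = c [ v ] , β , sym (rename-[] r c v)
β-rename⁻ r (app t u) (ξl st) with β-rename⁻ r t st
... | t' , a , refl = app t' u , ξl a , refl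
β-rename⁻ r (app t u) (ξr st) with β-rename⁻ r u st
... | u' , a , refl = app t u' , ξr a , refl

β*-rename⁻ : ∀ r t {s} → rename r t →β* s → ∃ λ t' → t →β* t' × s ≡ rename r t'
β*-rename⁻ r t ε = t , ε , refl
β*-rename⁻ r t (st ◅ ss) with β-rename⁻ r t st
... | t1 , a , refl with β*-rename⁻ r t1 ss
...   | t2 , b , e = t2 , a ◅ b , e

β*-lam : ∀ {t t'} → t →β* t' → lam t →β* lam t'
β*-lam = gmap lam ξlam

β*-app : ∀ {t t' u u'} → t →β* t' → u →β* u' → app t u →β* app t' u'
β*-app a b = gmap (λ x → app x _) ξl a ◅◅ gmap (app _) ξr b

≻f-appl : ∀ {t t' u} → t ≻f t' → app t u ≻f app t' u
≻f-appl = gmap (λ x → app x _) whap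

app-reduct : ∀ {t u n} → app t u →β* n →
  (∃ λ t' → ∃ λ u' → t →β* t' × u →β* u' × n ≡ app t' u') ⊎
  (∃ λ c → ∃ λ u' → t →β* lam c × u →β* u' × (c [ u' ]) →β* n)
app-reduct ε = inj₁ (_ , _ , ε , ε , refl)
app-reduct (β ◅ ss) = inj₂ (_ , _ , ε , ε , ss)
app-reduct (ξl s ◅ ss) with app-reduct ss
... | inj₁ (t' , u' , a , b , e) = inj₁ (t' , u' , s ◅ a , b , e)
... | inj₂ (c , u' , a , b , r) = inj₂ (c , u' , s ◅ a , b , r)
app-reduct (ξr s ◅ ss) with app-reduct ss
... | inj₁ (t' , u' , a , b , e) = inj₁ (t' , u' , a , s ◅ b , e)
... | inj₂ (c , u' , a , b , r) = inj₂ (c , u' , a , s ◅ b , r)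

var-reduct : ∀ {x n} → var x →β* n → n ≡ var x
var-reduct ε = refl
var-reduct (() ◅ _)

data Neutral : Λ → Set where
  ne-var : ∀ {x} → Neutral (var x)
  ne-app : ∀ {h w} → Neutral h → Neutral (app h w)

normal-var : ∀ {x} → Normal (var x)
normal-var ()

normal-lam : ∀ {c} → Normal c → Normal (lam c)
normal-lam n (ξlam s) = n s

normal-app : ∀ {h w} → Neutral h → Normal h → Normal w → Normal (app h w)
normal-app () nh nw β
normal-app _  nh nw (ξl s) = nh s
normal-app _  nh nw (ξr s) = nw s

-- Church–Rosser, by parallel reduction and complete developments

data _⇛_ : Λ → Λ → Set where
  ⇛var : ∀ {n} → var n ⇛ var n
  ⇛lam : ∀ {t t'} → t ⇛ t' → lam t ⇛ lam t'
  ⇛app : ∀ {t t' u u'} → t ⇛ t' → u ⇛ u' → app t u ⇛ app t' u'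
  ⇛β   : ∀ {t t' u u'} → t ⇛ t' → u ⇛ u' → app (lam t) u ⇛ (t' [ u' ])

⇛-refl : ∀ t → t ⇛ t
⇛-refl (var n)   = ⇛var
⇛-refl (lam t)   = ⇛lam (⇛-refl t)
⇛-refl (app t u) = ⇛app (⇛-refl t) (⇛-refl u)

β⊆⇛ : ∀ {t t'} → t →β t' → t ⇛ t'
β⊆⇛ β        = ⇛β (⇛-refl _) (⇛-refl _)
β⊆⇛ (ξlam s) = ⇛lam (β⊆⇛ s)
β⊆⇛ (ξl s)   = ⇛app (β⊆⇛ s) (⇛-refl _)
β⊆⇛ (ξr s)   = ⇛app (⇛-refl _) (β⊆⇛ s)

⇛⊆β* : ∀ {t t'} → t ⇛ t' → t →β* t'
⇛⊆β* ⇛var      = ε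
⇛⊆β* (⇛lam p)   = β*-lam (⇛⊆β* p)
⇛⊆β* (⇛app p q) = β*-app (⇛⊆β* p) (⇛⊆β* q)
⇛⊆β* (⇛β p q)   = β*-app (β*-lam (⇛⊆β* p)) (⇛⊆β* q) ◅◅ (β ◅ ε)

⇛-rename : ∀ r {t t'} → t ⇛ t' → rename r t ⇛ rename r t'
⇛-rename r ⇛var       = ⇛var
⇛-rename r (⇛lam p)   = ⇛lam (⇛-rename (ext r) p)
⇛-rename r (⇛app p q) = ⇛app (⇛-rename r p) (⇛-rename r q)
⇛-rename r (⇛β {t' = t'} {u' = u'} p q) =
  ≡subst (_ ⇛_) (sym (rename-[] r t' u')) (⇛β (⇛-rename (ext r) p) (⇛-rename r q))

⇛-exts : ∀ {σ σ'} → (∀ n → σ n ⇛ σ' n) → ∀ n → exts σ n ⇛ exts σ' n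
⇛-exts h zero    = ⇛var
⇛-exts h (suc n) = ⇛-rename suc (h n)

⇛-subst : ∀ {σ σ' t t'} → (∀ n → σ n ⇛ σ' n) → t ⇛ t' → subst σ t ⇛ subst σ' t'
⇛-subst h ⇛var       = h _
⇛-subst h (⇛lam p)   = ⇛lam (⇛-subst (⇛-exts h) p)
⇛-subst h (⇛app p q) = ⇛app (⇛-subst h p) (⇛-subst h q)
⇛-subst {σ' = σ'} h (⇛β {t' = t'} {u' = u'} p q) =
  ≡subst (_ ⇛_) (sym (subst-[] σ' t' u')) (⇛β (⇛-subst (⇛-exts h) p) (⇛-subst h q))

⇛-[] : ∀ {t t' u u'} → t ⇛ t' → u ⇛ u' → (t [ u ]) ⇛ (t' [ u' ])
⇛-[] {t} {t'} {u} {u'} p q =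
  subst₂ _⇛_ (sym ([]-as-subst t u)) (sym ([]-as-subst t' u')) (⇛-subst ⇛-single p)
  where
  ⇛-single : ∀ n → single u n ⇛ single u' n
  ⇛-single zero    = q
  ⇛-single (suc n) = ⇛var

develop : Λ → Λ
develop (var n)             = var n
develop (lam t)             = lam (develop t)
develop (app (lam t) u)     = (develop t) [ develop u ]
develop (app (var n) u)     = app (var n) (develop u)
develop (app (app t1 t2) u) = app (develop (app t1 t2)) (develop u)

⇛-develop : ∀ {t s} → t ⇛ s → s ⇛ develop t
⇛-develop ⇛var                      = ⇛var
⇛-develop (⇛lam p)                  = ⇛lam (⇛-develop p)
⇛-develop (⇛app {var n} ⇛var q)     = ⇛app ⇛var (⇛-develop q)
⇛-develop (⇛app {app _ _} p q)      = ⇛app (⇛-develop p) (⇛-develop q)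
⇛-develop (⇛app {lam _} (⇛lam p) q) = ⇛β (⇛-develop p) (⇛-develop q)
⇛-develop (⇛β p q)                  = ⇛-[] (⇛-develop p) (⇛-develop q)

⇛-strip : ∀ {t a b} → t ⇛ a → Star _⇛_ t b → ∃ λ c → Star _⇛_ a c × b ⇛ c
⇛-strip {a = a} p ε = a , ε , p
⇛-strip p (q ◅ qs) with ⇛-strip (⇛-develop q) qs
... | c , r , s = c , (⇛-develop p ◅ r) , s

⇛*-confluent : ∀ {t a b} → Star _⇛_ t a → Star _⇛_ t b → ∃ λ c → Star _⇛_ a c × Star _⇛_ b c
⇛*-confluent {b = b} ε qs = b , qs , ε
⇛*-confluent (p ◅ ps) qs with ⇛-strip p qs
... | c , r , s with ⇛*-confluent ps r
...   | d , u , v = d , u , (s ◅ v)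

⇛*⊆β* : ∀ {t t'} → Star _⇛_ t t' → t →β* t'
⇛*⊆β* ε        = ε
⇛*⊆β* (p ◅ ps) = ⇛⊆β* p ◅◅ ⇛*⊆β* ps

church-rosser : ∀ {t a b} → t →β* a → t →β* b → ∃ λ c → a →β* c × b →β* c
church-rosser p q with ⇛*-confluent (gmap (λ x → x) β⊆⇛ p) (gmap (λ x → x) β⊆⇛ q)
... | c , r , s = c , ⇛*⊆β* r , ⇛*⊆β* s

≃β-join : ∀ {t t'} → t ≃β t' → ∃ λ c → t →β* c × t' →β* c
≃β-join ε = _ , ε , ε
≃β-join (fwd s ◅ ss) with ≃β-join ss
... | c , a , b = c , s ◅ a , b
≃β-join (bwd s ◅ ss) with ≃β-join ss
... | c , a , b with church-rosser (s ◅ ε) a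
...   | d , x , y = d , x , b ◅◅ y

β*⊆≃β : ∀ {t t'} → t →β* t' → t ≃β t'
β*⊆≃β = gmap (λ x → x) fwd

-- Standardization: a reduction can be reorganized as weak head
-- reduction followed by standard reductions of the immediate subterms

data _↠s_ : Λ → Λ → Set where
  s-var : ∀ {t n} → t ≻f var n → t ↠s var n
  s-lam : ∀ {t a a'} → t ≻f lam a → a ↠s a' → t ↠s lam a'
  s-app : ∀ {t a a' b b'} → t ≻f app a b → a ↠s a' → b ↠s b' → t ↠s app a' b'

↠s-refl : ∀ t → t ↠s t
↠s-refl (var n)   = s-var ε
↠s-refl (lam t)   = s-lam ε (↠s-refl t)
↠s-refl (app t u) = s-app ε (↠s-refl t) (↠s-refl u)

↠s-≻f : ∀ {t t' s} → t ≻f t' → t' ↠s s → t ↠s s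
↠s-≻f p (s-var q)     = s-var (p ◅◅ q)
↠s-≻f p (s-lam q r)   = s-lam (p ◅◅ q) r
↠s-≻f p (s-app q r s) = s-app (p ◅◅ q) r s

↠s-rename : ∀ r {t s} → t ↠s s → rename r t ↠s rename r s
↠s-rename r (s-var p)     = s-var (≻f-rename r p)
↠s-rename r (s-lam p q)   = s-lam (≻f-rename r p) (↠s-rename (ext r) q)
↠s-rename r (s-app p q s) = s-app (≻f-rename r p) (↠s-rename r q) (↠s-rename r s)

↠s-subst : ∀ {σ σ' t s} → (∀ n → σ n ↠s σ' n) → t ↠s s → subst σ t ↠s subst σ' s
↠s-subst {σ} h (s-var p)     = ↠s-≻f (≻f-subst σ p) (h _)
↠s-subst {σ} h (s-lam p q)   = s-lam (≻f-subst σ p) (↠s-subst ↠s-exts q)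
  where
  ↠s-exts : ∀ n → exts σ n ↠s exts _ n
  ↠s-exts zero    = s-var ε
  ↠s-exts (suc n) = ↠s-rename suc (h n)
↠s-subst {σ} h (s-app p q s) = s-app (≻f-subst σ p) (↠s-subst h q) (↠s-subst h s)

↠s-[] : ∀ {c c' v v'} → c ↠s c' → v ↠s v' → (c [ v ]) ↠s (c' [ v' ])
↠s-[] {c} {c'} {v} {v'} p q =
  subst₂ _↠s_ (sym ([]-as-subst c v)) (sym ([]-as-subst c' v')) (↠s-subst ↠s-single p)
  where
  ↠s-single : ∀ n → single v n ↠s single v' n
  ↠s-single zero    = q
  ↠s-single (suc n) = s-var ε

↠s-β : ∀ {t s s'} → t ↠s s → s →β s' → t ↠s s'
↠s-β (s-app p (s-lam q r) s) β = ↠s-≻f (p ◅◅ ≻f-appl q ◅◅ (whβ ◅ ε)) (↠s-[] r s)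
↠s-β (s-lam p q)   (ξlam st) = s-lam p (↠s-β q st)
↠s-β (s-app p q r) (ξl st)   = s-app p (↠s-β q st) r
↠s-β (s-app p q r) (ξr st)   = s-app p q (↠s-β r st)

standardization : ∀ {t s} → t →β* s → t ↠s s
standardization = go (↠s-refl _)
  where
  go : ∀ {t a s} → t ↠s a → a →β* s → t ↠s s
  go p ε         = p
  go p (st ◅ ss) = go (↠s-β p st) ss

↠s⊆β* : ∀ {t s} → t ↠s s → t →β* s
↠s⊆β* (s-var p)     = ≻f⊆β* p
↠s⊆β* (s-lam p q)   = ≻f⊆β* p ◅◅ β*-lam (↠s⊆β* q)
↠s⊆β* (s-app p q r) = ≻f⊆β* p ◅◅ β*-app (↠s⊆β* q) (↠s⊆β* r)

data SpineRel (R : Λ → Λ → Set) : Λ → Λ → Set where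
  sp-var : ∀ {x} → SpineRel R (var x) (var x)
  sp-app : ∀ {h h' w w'} → SpineRel R h h' → R w w' → SpineRel R (app h w) (app h' w')

spineRel-neutral : ∀ {R h h'} → SpineRel R h h' → Neutral h'
spineRel-neutral sp-var       = ne-var
spineRel-neutral (sp-app p _) = ne-app (spineRel-neutral p)

spineRel-refl : ∀ {h} → Neutral h → SpineRel _→β*_ h h
spineRel-refl ne-var     = sp-var
spineRel-refl (ne-app n) = sp-app (spineRel-refl n) ε

neutral-reduct : ∀ {t s} → t ↠s s → Neutral s → ∃ λ h → t ≻f h × SpineRel _→β*_ h s
neutral-reduct (s-var p) ne-var = _ , p , sp-var
neutral-reduct (s-app {b = b} p q r) (ne-app n) with neutral-reduct q n
... | h , a , sr = app h b , p ◅◅ ≻f-appl a , sp-app sr (↠s⊆β* r)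

neutral-reduces : ∀ {h s} → Neutral h → h →β* s → SpineRel _→β*_ h s
neutral-reduces n ε = spineRel-refl n
neutral-reduces n (st ◅ ss) = compose (one-step n st) (neutral-reduces (spineRel-neutral (one-step n st)) ss)
  where
  one-step : ∀ {h s} → Neutral h → h →β s → SpineRel _→β*_ h s
  one-step ne-var ()
  one-step (ne-app ()) β
  one-step (ne-app n) (ξl st) = sp-app (one-step n st) ε
  one-step (ne-app n) (ξr st) = sp-app (spineRel-refl n) (st ◅ ε)
  compose : ∀ {x y z} → SpineRel _→β*_ x y → SpineRel _→β*_ y z → SpineRel _→β*_ x z
  compose sp-var       sp-var         = sp-var
  compose (sp-app p q) (sp-app p' q') = sp-app (compose p p') (q ◅◅ q')

weak-head-spine-stable : ∀ {t t' h} → t ≃β t' → t ≻f h → Neutral h →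
  ∃ λ h' → t' ≻f h' × SpineRel _≃β_ h h'
weak-head-spine-stable e p n with ≃β-join e
... | r , tr , t'r with church-rosser (≻f⊆β* p) tr
...   | s , hs , rs with neutral-reduces n hs
...     | sp1 with neutral-reduct (standardization (t'r ◅◅ rs)) (spineRel-neutral sp1)
...       | h' , q , sp2 = h' , q , join sp1 sp2
  where
  join : ∀ {a b c} → SpineRel _→β*_ a b → SpineRel _→β*_ c b → SpineRel _≃β_ a c
  join sp-var       sp-var         = sp-var
  join (sp-app x y) (sp-app x' y') =
    sp-app (join x x') (β*⊆≃β y ◅◅ EqClosure.symmetric _→β_ (β*⊆≃β y'))

⟦⟧-ext : ∀ A {I J} → (∀ Z → FreeIn Z A → I Z ≡ J Z) → ∀ t → (⟦ A ⟧ I) t → (⟦ A ⟧ J) t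
⟦⟧-ext (tvar X) h t (lift p) = lift (≡subst (λ G → proj₁ G t) (h X fvar) p)
⟦⟧-ext (A ⇒ B) h t f u a =
  ⟦⟧-ext B (λ Z z → h Z (fr z)) _ (f u (⟦⟧-ext A (λ Z z → sym (h Z (fl z))) u a))
⟦⟧-ext (all X A) {I} {J} h t f G = ⟦⟧-ext A agree t (f G)
  where
  agree : ∀ Z → FreeIn Z A → (I [ X ← G ]) Z ≡ (J [ X ← G ]) Z
  agree Z z with Z ≟ X
  ... | yes _ = refl
  ... | no ne = h Z (fall (λ e → ne (sym e)) z)

update-≡ : ∀ (I : Interp) X G → (I [ X ← G ]) X ≡ G
update-≡ I X G with X ≟ X
... | yes _ = refl
... | no ne = ⊥-elim (ne refl)

update-≢ : ∀ (I : Interp) X G Z → ¬ (Z ≡ X) → (I [ X ← G ]) Z ≡ I Z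
update-≢ I X G Z ne with Z ≟ X
... | yes e = ⊥-elim (ne e)
... | no _  = refl

-- Entries: types read through a renaming of their type variables

Renaming : Set
Renaming = List (ℕ × ℕ)

look : Renaming → ℕ → ℕ
look [] Z = Z
look ((X , Y) ∷ ρ) Z with Z ≟ X
... | yes _ = Y
... | no _  = look ρ Z

Entry : Set
Entry = Ty × Renaming

max-tvar : Ty → ℕ
max-tvar (tvar X)  = X
max-tvar (A ⇒ B)   = max-tvar A ⊔ max-tvar B
max-tvar (all X A) = X ⊔ max-tvar A

max-target : Renaming → ℕ
max-target []            = 0
max-target ((X , Y) ∷ ρ) = Y ⊔ max-target ρ

entry-bound : Entry → ℕ
entry-bound (N , ρ) = suc (max-tvar N ⊔ max-target ρ)

free-max-tvar : ∀ {Z A} → FreeIn Z A → Z ≤ max-tvar A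
free-max-tvar fvar = ≤-refl
free-max-tvar {A = A ⇒ B}   (fl z)     = ≤-trans (free-max-tvar z) (m≤m⊔n (max-tvar A) (max-tvar B))
free-max-tvar {A = A ⇒ B}   (fr z)     = ≤-trans (free-max-tvar z) (m≤n⊔m (max-tvar A) (max-tvar B))
free-max-tvar {A = all X A} (fall _ z) = ≤-trans (free-max-tvar z) (m≤n⊔m X (max-tvar A))

look-≤ : ∀ ρ Z → look ρ Z ≤ Z ⊔ max-target ρ
look-≤ [] Z = m≤m⊔n Z 0
look-≤ ((X , Y) ∷ ρ) Z with Z ≟ X
... | yes _ = ≤-trans (m≤m⊔n Y (max-target ρ)) (m≤n⊔m Z _)
... | no _  = ≤-trans (look-≤ ρ Z) (⊔-lub (m≤m⊔n Z _) (≤-trans (m≤n⊔m Y (max-target ρ)) (m≤n⊔m Z _)))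

look-bound : ∀ {Z N} ρ → FreeIn Z N → look ρ Z < entry-bound (N , ρ)
look-bound {Z} {N} ρ z =
  s≤s (≤-trans (look-≤ ρ Z) (⊔-lub (≤-trans (free-max-tvar z) (m≤m⊔n _ _)) (m≤n⊔m (max-tvar N) _)))

-- A coding of entries by natural numbers in which every entry has
-- arbitrarily large codes

-- Cantor's enumeration of ℕ × ℕ along the diagonals
unpair-step : ℕ × ℕ → ℕ × ℕ
unpair-step (a , zero)  = zero , suc a
unpair-step (a , suc k) = suc a , k

unpair : ℕ → ℕ × ℕ
unpair zero    = 0 , 0
unpair (suc n) = unpair-step (unpair n)

triangle : ℕ → ℕ
triangle zero    = 0
triangle (suc d) = triangle d + suc d

pair : ℕ → ℕ → ℕ
pair a k = triangle (a + k) + a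

unpair-diagonal : ∀ d j → j ≤ d → unpair (triangle d + j) ≡ (j , d ∸ j)
unpair-diagonal d zero _ = trans (cong unpair (+-identityʳ (triangle d))) (diagonal-start d)
  where
  diagonal-start : ∀ d → unpair (triangle d) ≡ (0 , d)
  diagonal-start zero    = refl
  diagonal-start (suc d) =
    trans (cong unpair (+-suc (triangle d) d))
          (cong unpair-step (trans (unpair-diagonal d d ≤-refl) (cong (d ,_) (n∸n≡0 d))))
unpair-diagonal d (suc j) p =
  trans (cong unpair (+-suc (triangle d) j))
        (trans (cong unpair-step (unpair-diagonal d j (≤-trans (n≤1+n j) p)))
               (cong (λ z → unpair-step (j , z)) (∸-suc d j p)))
  where
  ∸-suc : ∀ d j → suc j ≤ d → d ∸ j ≡ suc (d ∸ suc j)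
  ∸-suc (suc d) zero    _       = refl
  ∸-suc (suc d) (suc j) (s≤s p) = ∸-suc d j p

unpair-pair : ∀ a k → unpair (pair a k) ≡ (a , k)
unpair-pair a k = trans (unpair-diagonal (a + k) a (m≤m+n a k)) (cong (a ,_) (m+n∸m≡n a k))

pair-≥ : ∀ a k → k ≤ pair a k
pair-≥ a k = ≤-trans (m≤n+m k a) (≤-trans (triangle-≥ (a + k)) (m≤m+n _ a))
  where
  triangle-≥ : ∀ d → d ≤ triangle d
  triangle-≥ zero    = z≤n
  triangle-≥ (suc d) = m≤n+m (suc d) (triangle d)

encode-ty : Ty → ℕ
encode-ty (tvar r)  = pair 0 r
encode-ty (A ⇒ B)   = pair 1 (pair (encode-ty A) (encode-ty B))
encode-ty (all X A) = pair 2 (pair X (encode-ty A))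

decode-ty : ℕ → ℕ → Ty
decode-ty-tagged : ℕ → ℕ × ℕ → Ty
decode-ty zero    n = tvar 0
decode-ty (suc f) n = decode-ty-tagged f (unpair n)
decode-ty-tagged f (zero , r)        = tvar r
decode-ty-tagged f (suc zero , r)    = decode-ty f (proj₁ (unpair r)) ⇒ decode-ty f (proj₂ (unpair r))
decode-ty-tagged f (suc (suc _) , r) = all (proj₁ (unpair r)) (decode-ty f (proj₂ (unpair r)))

size-ty : Ty → ℕ
size-ty (tvar _)  = 1
size-ty (A ⇒ B)   = suc (size-ty A ⊔ size-ty B)
size-ty (all X A) = suc (size-ty A)

decode-encode-ty : ∀ N f → size-ty N ≤ f → decode-ty f (encode-ty N) ≡ N
decode-encode-ty (tvar r) (suc f) p rewrite unpair-pair 0 r = refl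
decode-encode-ty (A ⇒ B) (suc f) (s≤s p)
  rewrite unpair-pair 1 (pair (encode-ty A) (encode-ty B)) | unpair-pair (encode-ty A) (encode-ty B) =
  cong₂ _⇒_ (decode-encode-ty A f (≤-trans (m≤m⊔n _ _) p)) (decode-encode-ty B f (≤-trans (m≤n⊔m _ _) p))
decode-encode-ty (all X A) (suc f) (s≤s p)
  rewrite unpair-pair 2 (pair X (encode-ty A)) | unpair-pair X (encode-ty A) =
  cong (all X) (decode-encode-ty A f p)

encode-ren : Renaming → ℕ
encode-ren []            = pair 0 0
encode-ren ((p , q) ∷ ρ) = pair 1 (pair (pair p q) (encode-ren ρ))

decode-ren : ℕ → ℕ → Renaming
decode-ren-tagged : ℕ → ℕ × ℕ → Renaming
decode-ren zero    n = []
decode-ren (suc f) n = decode-ren-tagged f (unpair n)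
decode-ren-tagged f (zero , _)  = []
decode-ren-tagged f (suc _ , r) = unpair (proj₁ (unpair r)) ∷ decode-ren f (proj₂ (unpair r))

size-ren : Renaming → ℕ
size-ren []      = 1
size-ren (_ ∷ ρ) = suc (size-ren ρ)

decode-encode-ren : ∀ ρ f → size-ren ρ ≤ f → decode-ren f (encode-ren ρ) ≡ ρ
decode-encode-ren [] (suc f) p rewrite unpair-pair 0 0 = refl
decode-encode-ren ((a , b) ∷ ρ) (suc f) (s≤s p)
  rewrite unpair-pair 1 (pair (pair a b) (encode-ren ρ)) | unpair-pair (pair a b) (encode-ren ρ) | unpair-pair a b =
  cong ((a , b) ∷_) (decode-encode-ren ρ f p)

-- the code x of an entry comes paired with an arbitrary k; x itself is
-- used as fuel, which is enough since x ≥ k can be made large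
decode : ℕ → Entry
decode x = decode-ty x (proj₁ (unpair (proj₁ (unpair x)))) , decode-ren x (proj₂ (unpair (proj₁ (unpair x))))

decode-surjective : ∀ e K → ∃ λ x → K ≤ x × decode x ≡ e
decode-surjective (N , ρ) K = x , ≤-trans (m≤m+n K _) k≤x , decoded
  where
  n = pair (encode-ty N) (encode-ren ρ)
  k = K + (size-ty N + size-ren ρ)
  x = pair n k
  k≤x : k ≤ x
  k≤x = pair-≥ n k
  decoded : decode x ≡ (N , ρ)
  decoded rewrite unpair-pair n k | unpair-pair (encode-ty N) (encode-ren ρ) =
    cong₂ _,_ (decode-encode-ty N x (≤-trans (m≤m+n (size-ty N) _) (≤-trans (m≤n+m _ K) k≤x)))
              (decode-encode-ren ρ x (≤-trans (m≤n+m (size-ren ρ) (size-ty N)) (≤-trans (m≤n+m _ K) k≤x)))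

-- Syntactic realizability relative to the generic variables x ≥ b
module Realizability (b : ℕ) where

  -- the generic variable x carries the entry e; x also exceeds the type
  -- variables mentioned by e, so that fresh type variables can be chosen
  Carries : ℕ → Entry → Set
  Carries x e = b ≤ x × entry-bound e ≤ x × decode x ≡ e

  carries-unique : ∀ {x e e'} → Carries x e → Carries x e' → e ≡ e'
  carries-unique (_ , _ , p) (_ , _ , q) = trans (sym p) q

  carrier-exists : ∀ e K → ∃ λ x → K ≤ x × Carries x e
  carrier-exists e K with decode-surjective e (K ⊔ (b ⊔ entry-bound e))
  ... | x , le , de =
    x , ≤-trans (m≤m⊔n K _) le ,
    ≤-trans (≤-trans (m≤m⊔n b _) (m≤n⊔m K _)) le ,
    ≤-trans (≤-trans (m≤n⊔m b _) (m≤n⊔m K _)) le , de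

  -- Real ρ P t : t realizes P read through ρ;
  -- Spine h N ρe : h is a generic variable applied to realizers of the
  -- premises of its entry, leaving the conclusion N read through ρe
  data Real : Renaming → Ty → Λ → Set
  data Spine : Λ → Ty → Renaming → Set

  data Real where
    real-var : ∀ {ρ X t h ρe Y} → t ≻f h → Spine h (tvar Y) ρe → look ρe Y ≡ look ρ X → Real ρ (tvar X) t
    real-arr : ∀ {ρ N P t} → (∀ x → Carries x (N , ρ) → Real ρ P (app t (var x))) → Real ρ (N ⇒ P) t
    real-all : ∀ {ρ X Q t} → (∀ Y → Real ((X , Y) ∷ ρ) Q t) → Real ρ (all X Q) t

  data Spine where
    spine-var : ∀ {x N ρe} → Carries x (N , ρe) → Spine (var x) N ρe
    spine-app : ∀ {h w P N ρe} → Spine h (P ⇒ N) ρe → Real ρe P w → Spine (app h w) N ρe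

  spine-neutral : ∀ {h N ρe} → Spine h N ρe → Neutral h
  spine-neutral (spine-var _)   = ne-var
  spine-neutral (spine-app s _) = ne-app (spine-neutral s)

  Adapted : Interp → (ℕ → Λ) → Λ → Set₁
  Adapted θ σ t = ∀ x N ρe → Free x t → Carries x (N , ρe) → (⟦ N ⟧ (θ ∘ look ρe)) (σ x)

  update : (ℕ → Λ) → ℕ → Λ → ℕ → Λ
  update σ x u y with y ≟ x
  ... | yes _ = u
  ... | no _  = σ y

  update-at : ∀ σ x u → update σ x u x ≡ u
  update-at σ x u with x ≟ x
  ... | yes _ = refl
  ... | no ne = ⊥-elim (ne refl)

  update-off : ∀ σ x u y → ¬ (y ≡ x) → update σ x u y ≡ σ y
  update-off σ x u y ne with y ≟ x
  ... | yes e = ⊥-elim (ne e)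
  ... | no _  = refl

  real-sound : ∀ {ρ P t} → Real ρ P t → ∀ θ σ → Adapted θ σ t → (⟦ P ⟧ (θ ∘ look ρ)) (subst σ t)
  spine-sound : ∀ {h N ρe} → Spine h N ρe → ∀ θ σ → Adapted θ σ h → (⟦ N ⟧ (θ ∘ look ρe)) (subst σ h)

  -- the interpretation is saturated, so it passes from the spine back to t
  real-sound (real-var {ρ} {X} {t} {h} p s e) θ σ a
    with spine-sound s θ σ (λ x N ρ' f c → a x N ρ' (β*-free (≻f⊆β* p) f) c)
  ... | lift m = lift (proj₂ (θ (look ρ X)) (≡subst (λ Z → proj₁ (θ Z) (subst σ h)) e m) (≻f-subst σ p))
  -- to apply subst σ t to u, let a fresh generic variable x stand for u
  real-sound (real-arr {ρ} {N} {P} {t} k) θ σ a u mu with carrier-exists (N , ρ) (bound t)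
  ... | x , bound≤x , c = ≡subst (⟦ P ⟧ (θ ∘ look ρ)) σ'-on-tx (real-sound (k x c) θ σ' a')
    where
    σ' = update σ x u
    x-fresh : ∀ {y} → Free y t → ¬ (y ≡ x)
    x-fresh f refl = <⇒≱ (free-bound f) bound≤x
    σ'-on-tx : subst σ' (app t (var x)) ≡ app (subst σ t) u
    σ'-on-tx = cong₂ app (subst-agree t (λ y f → update-off σ x u y (x-fresh f))) (update-at σ x u)
    a' : Adapted θ σ' (app t (var x))
    a' y N' ρ' (fapl f) c' = ≡subst (⟦ N' ⟧ (θ ∘ look ρ')) (sym (update-off σ x u y (x-fresh f))) (a y N' ρ' f c')
    a' y N' ρ' (fapr fv) c' with carries-unique c c'
    ... | refl = ≡subst (⟦ N ⟧ (θ ∘ look ρ)) (sym (update-at σ x u)) mu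
  -- to instantiate X by G, send X to a type variable Y unused by t and ρ
  real-sound (real-all {ρ} {X} {Q} {t} k) θ σ a G =
    ⟦⟧-ext Q agree (subst σ t) (real-sound (k Y) θ' σ a')
    where
    Y = entry-bound (Q , ρ) + bound t
    θ' = θ [ Y ← G ]
    agree : ∀ Z → FreeIn Z Q → (θ' ∘ look ((X , Y) ∷ ρ)) Z ≡ ((θ ∘ look ρ) [ X ← G ]) Z
    agree Z z with Z ≟ X
    ... | yes _ = update-≡ θ Y G
    ... | no _  = update-≢ θ Y G (look ρ Z) (<⇒≢ (<-≤-trans (look-bound ρ z) (m≤m+n _ _)))
    a' : Adapted θ' σ t
    a' x N ρe f c = ⟦⟧-ext N unchanged (σ x) (a x N ρe f c)
      where
      Y-fresh : ∀ {Z} → FreeIn Z N → look ρe Z < Y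
      Y-fresh z = <-≤-trans (look-bound ρe z)
                    (≤-trans (proj₁ (proj₂ c)) (≤-trans (<⇒≤ (free-bound f)) (m≤n+m _ _)))
      unchanged : ∀ Z → FreeIn Z N → (θ ∘ look ρe) Z ≡ (θ' ∘ look ρe) Z
      unchanged Z z = sym (update-≢ θ Y G (look ρe Z) (<⇒≢ (Y-fresh z)))

  spine-sound (spine-var {x} {N} {ρe} c) θ σ a = a x N ρe fv c
  spine-sound (spine-app s r) θ σ a =
    spine-sound s θ σ (λ x N ρ' f c → a x N ρ' (fapl f) c) _
      (real-sound r θ σ (λ x N ρ' f c → a x N ρ' (fapr f) c))

  Generic : Λ → Set
  Generic n = ∀ y → Free y n → b ≤ y

  real-normalizes : ∀ {ρ P t} → Real ρ P t → ∃ λ n → t →β* n × Normal n × Generic n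
  spine-normalizes : ∀ {h N ρe} → Spine h N ρe → ∃ λ n → h →β* n × Normal n × Neutral n × Generic n

  real-normalizes (real-var p s e) with spine-normalizes s
  ... | n , r , nn , _ , g = n , ≻f⊆β* p ◅◅ r , nn , g
  -- the normal form of (t) x is either (t') x with t' normal, or comes from
  -- a redex (λ c) x, and then λ c normalizes as well
  real-normalizes (real-arr {ρ} {N} k) with carrier-exists (N , ρ) 0
  ... | x , _ , c with real-normalizes (k x c)
  ... | n , r , nn , g with app-reduct r
  ... | inj₁ (t' , u' , a , _ , refl) = t' , a , (λ s → nn (ξl s)) , λ y f → g y (fapl f)
  ... | inj₂ (c' , u' , a , x↠u' , r2) with var-reduct x↠u'
  ... | refl with β*-rename⁻ (instantiate x) c' (≡subst (_→β* n) ([var]-as-rename c' x) r2)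
  ... | c'' , r3 , refl =
    lam c'' , a ◅◅ β*-lam r3 , normal-lam (λ s → nn (β-rename (instantiate x) s)) ,
    λ { y (flam f) → g y (free-rename {instantiate x} f) }
  real-normalizes (real-all k) = real-normalizes (k 0)

  spine-normalizes (spine-var c) = _ , ε , normal-var , ne-var , λ { y fv → proj₁ c }
  spine-normalizes (spine-app s r) with spine-normalizes s | real-normalizes r
  ... | n1 , r1 , nn1 , ne1 , g1 | n2 , r2 , nn2 , g2 =
    app n1 n2 , β*-app r1 r2 , normal-app ne1 nn1 nn2 , ne-app ne1 ,
    λ { y (fapl f) → g1 y f ; y (fapr f) → g2 y f }

  real-stable : ∀ {ρ P t t'} → Real ρ P t → t ≃β t' → Real ρ P t'
  spine-stable : ∀ {h h' N ρe} → Spine h N ρe → SpineRel _≃β_ h h' → Spine h' N ρe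

  real-stable (real-var p s e) eq with weak-head-spine-stable eq p (spine-neutral s)
  ... | h' , q , sr = real-var q (spine-stable s sr) e
  real-stable (real-arr k) eq = real-arr λ x c → real-stable (k x c) (EqClosure.gmap (λ y → app y _) ξl eq)
  real-stable (real-all k) eq = real-all λ Y → real-stable (k Y) eq

  spine-stable (spine-var c) sp-var = spine-var c
  spine-stable (spine-app s r) (sp-app sr e) = spine-app (spine-stable s sr) (real-stable r e)

  generic-interp : Interp
  generic-interp Z =
    (λ v → ∃ λ h → ∃ λ ρe → ∃ λ Y → v ≻f h × Spine h (tvar Y) ρe × look ρe Y ≡ Z) ,
    λ { (h , ρe , Y , p , s , e) q → h , ρe , Y , q ◅◅ p , s , e }

  reify : ∀ {ρ P t} → ForallPos P → (⟦ P ⟧ (generic-interp ∘ look ρ)) t → Real ρ P t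
  reflect : ∀ {h N ρe} → ForallNeg N → Spine h N ρe → (⟦ N ⟧ (generic-interp ∘ look ρe)) h

  reify pvar (lift (h , ρe , Y , p , s , e)) = real-var p s e
  reify (parr nN pP) m = real-arr λ x c → reify pP (m (var x) (reflect nN (spine-var c)))
  reify {ρ} {all X Q} {t} (pall pQ _) m = real-all λ Y → reify pQ (⟦⟧-ext Q (agree Y) t (m (generic-interp Y)))
    where
    agree : ∀ Y Z → FreeIn Z Q →
      ((generic-interp ∘ look ρ) [ X ← generic-interp Y ]) Z ≡ (generic-interp ∘ look ((X , Y) ∷ ρ)) Z
    agree Y Z z with Z ≟ X
    ... | yes _ = refl
    ... | no _  = refl

  reflect nvar s = lift (_ , _ , _ , ε , s , refl)
  reflect (narr pP nN) s = λ w m → reflect nN (spine-app s (reify pP m))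

  real-of-element : ∀ {A t} → ForallPos A → ∣ A ∣ t → Real [] A t
  real-of-element pos h = reify pos (h generic-interp)

-- (i) elements of a ∀⁺ type have closed normal forms: take the generic
-- variables above the free variables of t
closed-normal-form : ∀ {A} → ForallPos A → ∀ t → ∣ A ∣ t → ∃ λ n → t →β* n × Normal n × Closed n
closed-normal-form pos t h
  with Realizability.real-normalizes (bound t) (Realizability.real-of-element (bound t) pos h)
... | n , r , nn , g = n , r , nn , closedUnder 0 n no-free
  where
  no-free : ∀ y → Free y n → y < 0
  no-free y f = ⊥-elim (<⇒≱ (free-bound (β*-free r f)) (g y f))

-- (ii) ∀⁺ types are closed under β-equivalence: the realizer t' of A is
-- sent into |A|_I by the identity substitution, t' having no generic variable
β-stable : ∀ {A} → ForallPos A → ∀ t t' → ∣ A ∣ t → t ≃β t' → ∣ A ∣ t'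
β-stable {A} pos t t' h eq I =
  ≡subst (⟦ A ⟧ I) (subst-id t') (real-sound (real-stable (real-of-element pos h) eq) I var no-generic)
  where
  open Realizability (bound t')
  no-generic : Adapted I var t'
  no-generic x N ρe f c = ⊥-elim (<⇒≱ (free-bound f) (proj₁ c))

mainTheorem3 : (A : Ty) → ForallPos A →
    ((t : Λ) → ∣ A ∣ t → Normalizable t × (∃ λ u → Closed u × (t ≃β u)))
    × ((t t' : Λ) → ∣ A ∣ t → t ≃β t' → ∣ A ∣ t')
mainTheorem3 A pos = normal-closed , β-stable pos
  where
  normal-closed : (t : Λ) → ∣ A ∣ t → Normalizable t × (∃ λ u → Closed u × (t ≃β u))
  normal-closed t h with closed-normal-form pos t h
  ... | n , r , nn , closed = (n , r , nn) , n , closed , β*⊆≃β r
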